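{- Let $n=5$. The facets of the cone $\tau_5 \subset \mathbb{R}^{10}$ are exactly those with facet normals the $(2,3)$-cut vectors; that is, up to isomorphism (the action of $\mathcal{S}_5$ on vertices) the only facet of $\tau_5$ is the $(2,3)$-cut, and $\tau_5$ has a total of $10$ facets.
   Context: Vectors in $\mathbb{R}^{\binom{n}{2}}$ are indexed by the $2$-subsets (edges) of $[n]$. For a $3$-subset $K$, $\mathds{1}_K$ denotes the vector equal to $1$ on the three $2$-subsets of $K$ and $0$ elsewhere (a triangle). $\tau_n$ is the cone generated by all triangles. The symmetric group $\mathcal{S}_n$ acts on vectors by permuting vertices, $y^\alpha(e)=y(\alpha^{ -1}e)$; two vectors/facets are isomorphic if related by this action. For a partition $(A,B)$ of $[n]$, the $(|A|,|B|)$-cut is the vector $y$ with $y(e)=2$ if $e\subseteq A$ or $e\subseteq B$, and $y(e)=-1$ otherwise. A facet is a face of codimension $1$; its normal is the vector $y$ (unique up to positive scaling) with $\langle y,\mathds{1}_K\rangle\ge 0$ for all triangles and vanishing exactly on the triangles of the facet.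
   Formalization: The facet normals of $\tau_5$ and their positive scaling factors are taken over the rationals rather than the reals. -}

module Defs where

open import Data.Nat as ℕ using (ℕ; zero; suc)
open import Data.Fin as F using (Fin; zero; suc)
open import Data.Fin.Properties using (_<?_; _≟_)
open import Data.Bool as B using (Bool; true; false; if_then_else_; _∨_; _∧_)
open import Data.Bool.Properties as BP using ()
open import Data.Maybe using (Maybe; just; nothing)
open import Data.List using (List; []; _∷_; length; map; foldr; concatMap; mapMaybe; allFin)
open import Data.List.Relation.Unary.All using (All)
open import Data.Vec using (lookup)
open import Data.Fin.Subset using (Subset)
open import Data.Rational using (ℚ; 0ℚ; 1ℚ; _+_; _*_; -_; _≤_; _<_)
open import Data.Product using (Σ; _×_; _,_)
open import Data.Unit using (⊤)
open import Relation.Nullary using (yes; no; does)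
open import Relation.Binary.PropositionalEquality using (_≡_)

V : Set
V = Fin 5

record Edge : Set where
  constructor edge
  field
    i j : V
    i<j : i F.< j
open Edge public

record Triangle : Set where
  constructor tri
  field
    a b c : V
    a<b : a F.< b
    b<c : b F.< c
open Triangle public

ltEdge : V → V → Maybe Edge
ltEdge x y with x <? y
... | yes p = just (edge x y p)
... | no _  = nothing

edges : List Edge
edges = concatMap (λ x → mapMaybe (ltEdge x) (allFin 5)) (allFin 5)

ltTri : V → V → V → Maybe Triangle
ltTri x y z with x <? y | y <? z
... | yes p | yes q = just (tri x y z p q)
... | _     | _     = nothing

triangles : List Triangle
triangles = concatMap (λ x → concatMap (λ y → mapMaybe (ltTri x y) (allFin 5)) (allFin 5)) (allFin 5)

-- vectors in ℝ^(5 choose 2), with rational coordinates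
Vector : Set
Vector = Edge → ℚ

⟨_,_⟩ : Vector → Vector → ℚ
⟨ y , x ⟩ = foldr _+_ 0ℚ (map (λ e → y e * x e) edges)

_∈T_ : V → Triangle → Bool
v ∈T K = does (v ≟ a K) ∨ does (v ≟ b K) ∨ does (v ≟ c K)

𝟙 : Triangle → Vector
𝟙 K e = if (i e ∈T K) ∧ (j e ∈T K) then 1ℚ else 0ℚ

comb : (vs : List Vector) → (Fin (length vs) → ℚ) → Vector
comb []       γ e = 0ℚ
comb (v ∷ vs) γ e = γ zero * v e + comb vs (λ ℓ → γ (suc ℓ)) e

LinIndep : List Vector → Set
LinIndep vs = (γ : Fin (length vs) → ℚ) → (∀ e → comb vs γ e ≡ 0ℚ) → ∀ ℓ → γ ℓ ≡ 0ℚ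

-- the set of triangles satisfying P spans a space of dimension r
HasRank : (Triangle → Set) → ℕ → Set
HasRank P r =
  Σ (List Triangle) (λ L → All P L × length L ≡ r × LinIndep (map 𝟙 L))
  × ((L : List Triangle) → All P L → LinIndep (map 𝟙 L) → length L ℕ.≤ r)

-- y is valid for τ_5: ⟨y, 𝟙_K⟩ ≥ 0 for all triangles K
Valid : Vector → Set
Valid y = (K : Triangle) → 0ℚ ≤ ⟨ y , 𝟙 K ⟩

Tight : Vector → Triangle → Set
Tight y K = ⟨ y , 𝟙 K ⟩ ≡ 0ℚ

-- y is the normal of a facet: valid, and the face it cuts out (the cone on its
-- tight triangles) has dimension dim τ_5 − 1
IsFacetNormal : Vector → Set
IsFacetNormal y = Valid y × Σ ℕ (λ d → HasRank (λ _ → ⊤) (suc d) × HasRank (Tight y) d)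

-- a facet, identified by the set S of triangles it contains
IsFacet : (Triangle → Bool) → Set
IsFacet S = Σ Vector (λ y → IsFacetNormal y ×
              ((K : Triangle) → (S K ≡ true → Tight y K) × (Tight y K → S K ≡ true)))

cut : Subset 5 → Vector
cut A e = if does (lookup A (i e) BP.≟ lookup A (j e)) then 1ℚ + 1ℚ else - 1ℚ

-- The ten triangle vectors form a basis of ℝ¹⁰ whose dual basis consists, up to the factor 6,
-- of the (2,3)-cuts: the cut whose 3-side is K pairs to 6 with 𝟙_K and to 0 with every other
-- triangle. So τ₅ is a simplicial cone. A valid y whose tight triangles have rank 9 vanishes on
-- all triangles but one, K, hence has the same pairings with the triangles as a positive
-- multiple of the cut dual to K, and so equals it. The ten facets are the cones on the ten
-- sets of nine triangles.

module Submission where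

open import Defs
open import Algebra.Bundles using (CommutativeMonoid)
open import Data.Bool using (Bool; true; false; if_then_else_)
import Data.Bool.Properties as BoolP
open import Data.Empty using (⊥-elim)
open import Data.Fin using (Fin; zero; suc)
open import Data.Fin.Properties using (<-irrelevant) renaming (_≟_ to _≟ᶠ_; _<?_ to _<ᶠ?_)
open import Data.Fin.Subset using (Subset; ∁; ∣_∣)
open import Data.Fin.Subset.Properties using (anySubset?)
import Data.Integer as ℤ
open import Data.List using (List; []; _∷_; length; map; foldr; filter; concatMap; mapMaybe; allFin)
open import Data.List.Membership.Propositional using (_∈_)
open import Data.List.Membership.Propositional.Properties
  using (∈-allFin; ∈-concatMap⁺; ∈-filter⁺; ∈-filter⁻; ∈-map⁺)
open import Data.List.Properties using (filter-≐; length-removeAt′)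
open import Data.List.Relation.Binary.Subset.Propositional using (_⊆_)
open import Data.List.Relation.Unary.All as All using (All; []; _∷_)
open import Data.List.Relation.Unary.All.Properties as AllP using (all-filter)
open import Data.List.Relation.Unary.AllPairs as AllPairs using (AllPairs; []; _∷_)
import Data.List.Relation.Unary.AllPairs.Properties as AllPairsP
open import Data.List.Relation.Unary.Any as Any using (Any; here; there)
import Data.List.Relation.Unary.Any.Properties as AnyP
open import Data.List.Relation.Unary.Unique.Propositional using (Unique)
import Data.List.Relation.Unary.Unique.Propositional.Properties as UniqueP
open import Data.Maybe using (Maybe; just; nothing)
open import Data.Nat as ℕ using (ℕ; zero; suc; z≤n; s≤s)
import Data.Nat.Properties as ℕP
open import Data.Product using (Σ; ∃; _×_; _,_; proj₁; proj₂)
open import Data.Rational using (ℚ; 0ℚ; 1ℚ; _+_; _*_; -_; _/_; _≤_; _<_; Positive)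
import Data.Rational.Properties as ℚP
open import Data.Unit using (tt)
open import Data.Vec using (tabulate)
import Data.Vec.Properties as VecP
open import Function using (_∘_; _⇔_; mk⇔; Equivalence)
open import Function.Construct.Composition using (_⇔-∘_)
open import Function.Construct.Symmetry using (⇔-sym)
open import Relation.Binary.Definitions using (DecidableEquality; tri<; tri≈; tri>)
open import Relation.Binary.PropositionalEquality
open import Relation.Nullary using (Dec; yes; no; does; ¬_)
open import Relation.Nullary.Decidable using (toWitness; decidable-stable; ¬?; _×-dec_)
open import Relation.Unary using (Decidable)
open import Relation.Unary.Properties using (∁?)

open import Algebra.Properties.CommutativeSemigroup
  (CommutativeMonoid.commutativeSemigroup ℚP.+-0-commutativeMonoid) using (interchange)
open import Algebra.Properties.CommutativeSemigroup
  (CommutativeMonoid.commutativeSemigroup ℚP.*-1-commutativeMonoid) using (x∙yz≈y∙xz)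

_≟ᵀ_ : DecidableEquality Triangle
tri a b c p q ≟ᵀ tri a′ b′ c′ p′ q′ with a ≟ᶠ a′ | b ≟ᶠ b′ | c ≟ᶠ c′
... | yes refl | yes refl | yes refl = yes (cong₂ (tri a b c) (<-irrelevant p p′) (<-irrelevant q q′))
... | no a≢a′  | _        | _        = no λ { refl → a≢a′ refl }
... | yes _    | no b≢b′  | _        = no λ { refl → b≢b′ refl }
... | yes _    | yes _    | no c≢c′  = no λ { refl → c≢c′ refl }

_≟ᴱ_ : DecidableEquality Edge
edge i j p ≟ᴱ edge i′ j′ p′ with i ≟ᶠ i′ | j ≟ᶠ j′
... | yes refl | yes refl = yes (cong (edge i j) (<-irrelevant p p′))
... | no i≢i′  | _        = no λ { refl → i≢i′ refl }
... | yes _    | no j≢j′  = no λ { refl → j≢j′ refl }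

∈-mapMaybe⁺ : {A B : Set} (f : A → Maybe B) {x : A} {y : B} {xs : List A} →
              x ∈ xs → f x ≡ just y → y ∈ mapMaybe f xs
∈-mapMaybe⁺ f {xs = _ ∷ _} (here refl) fx≡y rewrite fx≡y = here refl
∈-mapMaybe⁺ f {xs = x′ ∷ _} (there x∈xs) fx≡y with f x′
... | just _  = there (∈-mapMaybe⁺ f x∈xs fx≡y)
... | nothing = ∈-mapMaybe⁺ f x∈xs fx≡y

∈-concatMap⁺′ : {A B : Set} (f : A → List B) {x : A} {y : B} {xs : List A} →
                x ∈ xs → y ∈ f x → y ∈ concatMap f xs
∈-concatMap⁺′ f x∈xs y∈fx = ∈-concatMap⁺ f (Any.map (λ { refl → y∈fx }) x∈xs)

ltTri-complete : ∀ K → ltTri (a K) (b K) (c K) ≡ just K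
ltTri-complete (tri a b c p q) with a <ᶠ? b | b <ᶠ? c
... | yes p′ | yes q′ = cong just (cong₂ (tri a b c) (<-irrelevant p′ p) (<-irrelevant q′ q))
... | no ¬p  | _      = ⊥-elim (¬p p)
... | yes _  | no ¬q  = ⊥-elim (¬q q)

ltEdge-complete : ∀ e → ltEdge (i e) (j e) ≡ just e
ltEdge-complete (edge i j p) with i <ᶠ? j
... | yes p′ = cong just (cong (edge i j) (<-irrelevant p′ p))
... | no ¬p  = ⊥-elim (¬p p)

∈-triangles : ∀ K → K ∈ triangles
∈-triangles K =
  ∈-concatMap⁺′ (λ x → concatMap (λ y → mapMaybe (ltTri x y) (allFin 5)) (allFin 5)) (∈-allFin (a K))
    (∈-concatMap⁺′ (λ y → mapMaybe (ltTri (a K) y) (allFin 5)) (∈-allFin (b K))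
      (∈-mapMaybe⁺ (ltTri (a K) (b K)) (∈-allFin (c K)) (ltTri-complete K)))

∈-edges : ∀ e → e ∈ edges
∈-edges e =
  ∈-concatMap⁺′ (λ x → mapMaybe (ltEdge x) (allFin 5)) (∈-allFin (i e))
    (∈-mapMaybe⁺ (ltEdge (i e)) (∈-allFin (j e)) (ltEdge-complete e))

triangles-unique : Unique triangles
triangles-unique = toWitness {a? = AllPairs.allPairs? (λ K K′ → ¬? (K ≟ᵀ K′)) triangles} _

edges-unique : Unique edges
edges-unique = toWitness {a? = AllPairs.allPairs? (λ e e′ → ¬? (e ≟ᴱ e′)) edges} _

∀-triangles : {P : Triangle → Set} → All P triangles → ∀ K → P K
∀-triangles P-all K = All.lookup P-all (∈-triangles K)

∀-edges : {P : Edge → Set} → All P edges → ∀ e → P e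
∀-edges P-all e = All.lookup P-all (∈-edges e)

δ : {A : Set} → DecidableEquality A → A → A → ℚ
δ _≟_ x y = if does (x ≟ y) then 1ℚ else 0ℚ

module _ {A : Set} (_≟_ : DecidableEquality A) where

  δ-refl : ∀ x → δ _≟_ x x ≡ 1ℚ
  δ-refl x with x ≟ x
  ... | yes _   = refl
  ... | no x≢x = ⊥-elim (x≢x refl)

  δ-≢ : ∀ {x y} → x ≢ y → δ _≟_ x y ≡ 0ℚ
  δ-≢ {x} {y} x≢y with x ≟ y
  ... | yes x≡y = ⊥-elim (x≢y x≡y)
  ... | no _    = refl

∑ : {A : Set} → List A → (A → ℚ) → ℚ
∑ xs f = foldr _+_ 0ℚ (map f xs)

infix 5 ∑
syntax ∑ xs (λ x → e) = ∑[ x ∈ xs ] e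

module _ {A : Set} where

  ∑-cong : (xs : List A) {f g : A → ℚ} → (∀ x → f x ≡ g x) → ∑ xs f ≡ ∑ xs g
  ∑-cong []       f≗g = refl
  ∑-cong (x ∷ xs) f≗g = cong₂ _+_ (f≗g x) (∑-cong xs f≗g)

  ∑-zero : (xs : List A) → ∑[ _ ∈ xs ] 0ℚ ≡ 0ℚ
  ∑-zero []       = refl
  ∑-zero (x ∷ xs) = cong (0ℚ +_) (∑-zero xs)

  ∑-+ : (xs : List A) (f g : A → ℚ) → ∑[ x ∈ xs ] f x + g x ≡ ∑ xs f + ∑ xs g
  ∑-+ []       f g = refl
  ∑-+ (x ∷ xs) f g =
    trans (cong (f x + g x +_) (∑-+ xs f g)) (interchange (f x) (g x) (∑ xs f) (∑ xs g))

  ∑-*ˡ : (xs : List A) (c : ℚ) (f : A → ℚ) → ∑[ x ∈ xs ] c * f x ≡ c * ∑ xs f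
  ∑-*ˡ []       c f = sym (ℚP.*-zeroʳ c)
  ∑-*ˡ (x ∷ xs) c f =
    trans (cong (c * f x +_) (∑-*ˡ xs c f)) (sym (ℚP.*-distribˡ-+ c (f x) (∑ xs f)))

  module _ (_≟_ : DecidableEquality A) (g : A → ℚ) where

    ∑-δ-∉ : ∀ {x} (xs : List A) → All (x ≢_) xs → ∑[ y ∈ xs ] g y * δ _≟_ x y ≡ 0ℚ
    ∑-δ-∉ []       []             = refl
    ∑-δ-∉ (y ∷ xs) (x≢y ∷ x∉xs) =
      cong₂ _+_ (trans (cong (g y *_) (δ-≢ _≟_ x≢y)) (ℚP.*-zeroʳ (g y))) (∑-δ-∉ xs x∉xs)

    ∑-δ : ∀ {x} (xs : List A) → Unique xs → x ∈ xs → ∑[ y ∈ xs ] g y * δ _≟_ x y ≡ g x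
    ∑-δ (y ∷ xs) (y∉xs ∷ _) (here refl) = begin
      g y * δ _≟_ y y + (∑[ z ∈ xs ] g z * δ _≟_ y z)
        ≡⟨ cong₂ _+_ (cong (g y *_) (δ-refl _≟_ y)) (∑-δ-∉ xs y∉xs) ⟩
      g y * 1ℚ + 0ℚ
        ≡⟨ ℚP.+-identityʳ _ ⟩
      g y * 1ℚ
        ≡⟨ ℚP.*-identityʳ (g y) ⟩
      g y ∎
      where open ≡-Reasoning
    ∑-δ (y ∷ xs) (y∉xs ∷ xs-unique) (there x∈xs) = begin
      g y * δ _≟_ _ y + (∑[ z ∈ xs ] g z * δ _≟_ _ z)
        ≡⟨ cong₂ _+_ y-term (∑-δ xs xs-unique x∈xs) ⟩
      0ℚ + g _
        ≡⟨ ℚP.+-identityˡ _ ⟩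
      g _ ∎
      where
      open ≡-Reasoning
      y-term : g y * δ _≟_ _ y ≡ 0ℚ
      y-term = trans (cong (g y *_) (δ-≢ _≟_ λ { refl → All.lookup y∉xs x∈xs refl })) (ℚP.*-zeroʳ (g y))

∑-swap : {A B : Set} (xs : List A) (ys : List B) (f : A → B → ℚ) →
         ∑[ x ∈ xs ] ∑[ y ∈ ys ] f x y ≡ ∑[ y ∈ ys ] ∑[ x ∈ xs ] f x y
∑-swap []       ys f = sym (∑-zero ys)
∑-swap (x ∷ xs) ys f =
  trans (cong (∑ ys (f x) +_) (∑-swap xs ys f)) (sym (∑-+ ys (f x) λ y → ∑[ x ∈ xs ] f x y))

-- The cuts as a dual basis

infixl 7 _·_
_·_ : ℚ → Vector → Vector
(γ · v) e = γ * v e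

⟨⟩-·ˡ : ∀ γ v x → ⟨ γ · v , x ⟩ ≡ γ * ⟨ v , x ⟩
⟨⟩-·ˡ γ v x = trans (∑-cong edges λ e → ℚP.*-assoc γ (v e) (x e)) (∑-*ˡ edges γ λ e → v e * x e)

⟨⟩-zeroʳ : ∀ v x → (∀ e → x e ≡ 0ℚ) → ⟨ v , x ⟩ ≡ 0ℚ
⟨⟩-zeroʳ v x x≗0 =
  trans (∑-cong edges λ e → trans (cong (v e *_) (x≗0 e)) (ℚP.*-zeroʳ (v e))) (∑-zero edges)

six : ℚ
six = ℤ.+ 6 / 1

*-cancelˡ-≡-pos : ∀ r .{{_ : Positive r}} {p q} → r * p ≡ r * q → p ≡ q
*-cancelˡ-≡-pos r rp≡rq = ℚP.≤-antisym (ℚP.*-cancelˡ-≤-pos r (ℚP.≤-reflexive rp≡rq))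
                                       (ℚP.*-cancelˡ-≤-pos r (ℚP.≤-reflexive (sym rp≡rq)))

≤∧≢⇒< : ∀ {p q : ℚ} → p ≤ q → p ≢ q → p < q
≤∧≢⇒< {p} {q} p≤q p≢q with ℚP.<-cmp p q
... | tri< p<q _   _   = p<q
... | tri≈ _   p≡q _   = ⊥-elim (p≢q p≡q)
... | tri> _   _   q<p = ⊥-elim (ℚP.<-irrefl refl (ℚP.≤-<-trans p≤q q<p))

vertices : Triangle → Subset 5
vertices K = tabulate (_∈T K)

cutAt : Triangle → Vector
cutAt K = cut (∁ (vertices K))

cutAt-dual : ∀ K K′ → ⟨ cutAt K , 𝟙 K′ ⟩ ≡ six * δ _≟ᵀ_ K K′
cutAt-dual = ∀-triangles (All.map ∀-triangles table)
  where
  table = toWitness {a? = All.all? (λ K → All.all? (λ K′ →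
            ⟨ cutAt K , 𝟙 K′ ⟩ ℚP.≟ six * δ _≟ᵀ_ K K′) triangles) triangles} _

-- The same identity with the roles of triangles and edges exchanged; it lets the cuts recover
-- a vector from its pairings with the triangles.
cutAt-𝟙-sum : ∀ e e′ → ∑[ K ∈ triangles ] cutAt K e * 𝟙 K e′ ≡ six * δ _≟ᴱ_ e e′
cutAt-𝟙-sum = ∀-edges (All.map ∀-edges table)
  where
  table = toWitness {a? = All.all? (λ e → All.all? (λ e′ →
            ∑[ K ∈ triangles ] cutAt K e * 𝟙 K e′ ℚP.≟ six * δ _≟ᴱ_ e e′) edges) edges} _

∑-cutAt-pairing : ∀ y e → ∑[ K ∈ triangles ] cutAt K e * ⟨ y , 𝟙 K ⟩ ≡ six * y e
∑-cutAt-pairing y e = begin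
  ∑[ K ∈ triangles ] cutAt K e * ⟨ y , 𝟙 K ⟩
    ≡⟨ ∑-cong triangles (λ K → sym (∑-*ˡ edges (cutAt K e) λ e′ → y e′ * 𝟙 K e′)) ⟩
  ∑[ K ∈ triangles ] ∑[ e′ ∈ edges ] cutAt K e * (y e′ * 𝟙 K e′)
    ≡⟨ ∑-swap triangles edges (λ K e′ → cutAt K e * (y e′ * 𝟙 K e′)) ⟩
  ∑[ e′ ∈ edges ] ∑[ K ∈ triangles ] cutAt K e * (y e′ * 𝟙 K e′)
    ≡⟨ ∑-cong edges (λ e′ → trans (∑-cong triangles λ K → x∙yz≈y∙xz (cutAt K e) (y e′) (𝟙 K e′))
                                   (∑-*ˡ triangles (y e′) λ K → cutAt K e * 𝟙 K e′)) ⟩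
  ∑[ e′ ∈ edges ] y e′ * (∑[ K ∈ triangles ] cutAt K e * 𝟙 K e′)
    ≡⟨ ∑-cong edges (λ e′ → trans (cong (y e′ *_) (cutAt-𝟙-sum e e′)) (x∙yz≈y∙xz (y e′) six (δ _≟ᴱ_ e e′))) ⟩
  ∑[ e′ ∈ edges ] six * (y e′ * δ _≟ᴱ_ e e′)
    ≡⟨ ∑-*ˡ edges six (λ e′ → y e′ * δ _≟ᴱ_ e e′) ⟩
  six * (∑[ e′ ∈ edges ] y e′ * δ _≟ᴱ_ e e′)
    ≡⟨ cong (six *_) (∑-δ _≟ᴱ_ y edges edges-unique (∈-edges e)) ⟩
  six * y e ∎
  where open ≡-Reasoning

triangle-pairing-injective : ∀ y w → (∀ K → ⟨ y , 𝟙 K ⟩ ≡ ⟨ w , 𝟙 K ⟩) → ∀ e → y e ≡ w e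
triangle-pairing-injective y w y≈w e = *-cancelˡ-≡-pos six (begin
  six * y e                                  ≡⟨ sym (∑-cutAt-pairing y e) ⟩
  ∑[ K ∈ triangles ] cutAt K e * ⟨ y , 𝟙 K ⟩ ≡⟨ ∑-cong triangles (λ K → cong (cutAt K e *_) (y≈w K)) ⟩
  ∑[ K ∈ triangles ] cutAt K e * ⟨ w , 𝟙 K ⟩ ≡⟨ ∑-cutAt-pairing w e ⟩
  six * w e                                  ∎)
  where open ≡-Reasoning

cutAt-dual-refl : ∀ K → ⟨ cutAt K , 𝟙 K ⟩ ≡ six
cutAt-dual-refl K = trans (cutAt-dual K K) (cong (six *_) (δ-refl _≟ᵀ_ K))

cutAt-dual-≢ : ∀ {K K′} → K ≢ K′ → ⟨ cutAt K , 𝟙 K′ ⟩ ≡ 0ℚ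
cutAt-dual-≢ {K} {K′} K≢K′ = trans (cutAt-dual K K′) (cong (six *_) (δ-≢ _≟ᵀ_ K≢K′))

-- Linear independence and rank

⟨⟩-comb-∷ : ∀ w v vs (γ : Fin (suc (length vs)) → ℚ) →
            ⟨ w , comb (v ∷ vs) γ ⟩ ≡ γ zero * ⟨ w , v ⟩ + ⟨ w , comb vs (γ ∘ suc) ⟩
⟨⟩-comb-∷ w v vs γ = begin
  ∑[ e ∈ edges ] w e * (γ zero * v e + comb vs (γ ∘ suc) e)
    ≡⟨ ∑-cong edges (λ e → trans (ℚP.*-distribˡ-+ (w e) _ _)
                                  (cong (_+ w e * comb vs (γ ∘ suc) e) (x∙yz≈y∙xz (w e) (γ zero) (v e)))) ⟩
  ∑[ e ∈ edges ] γ zero * (w e * v e) + w e * comb vs (γ ∘ suc) e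
    ≡⟨ ∑-+ edges (λ e → γ zero * (w e * v e)) (λ e → w e * comb vs (γ ∘ suc) e) ⟩
  (∑[ e ∈ edges ] γ zero * (w e * v e)) + ⟨ w , comb vs (γ ∘ suc) ⟩
    ≡⟨ cong (_+ ⟨ w , comb vs (γ ∘ suc) ⟩) (∑-*ˡ edges (γ zero) λ e → w e * v e) ⟩
  γ zero * ⟨ w , v ⟩ + ⟨ w , comb vs (γ ∘ suc) ⟩ ∎
  where open ≡-Reasoning

⟨⟩-comb-orthogonal : ∀ w vs (γ : Fin (length vs) → ℚ) →
                     All (λ v → ⟨ w , v ⟩ ≡ 0ℚ) vs → ⟨ w , comb vs γ ⟩ ≡ 0ℚ
⟨⟩-comb-orthogonal w []       γ []           = ⟨⟩-zeroʳ w (comb [] γ) λ _ → refl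
⟨⟩-comb-orthogonal w (v ∷ vs) γ (w⊥v ∷ w⊥vs) =
  trans (⟨⟩-comb-∷ w v vs γ)
        (cong₂ _+_ (trans (cong (γ zero *_) w⊥v) (ℚP.*-zeroʳ (γ zero)))
                   (⟨⟩-comb-orthogonal w vs (γ ∘ suc) w⊥vs))

unique⇒linIndep : (L : List Triangle) → Unique L → LinIndep (map 𝟙 L)
unique⇒linIndep []      []               γ _      ()
unique⇒linIndep (K ∷ L) (K∉L ∷ L-unique) γ comb≗0 = λ where
    zero    → γ₀≡0
    (suc ℓ) → unique⇒linIndep L L-unique (γ ∘ suc) tail≗0 ℓ
  where
  -- pairing with cutAt K isolates the coefficient of 𝟙 K
  γ₀*six≡0 : γ zero * six ≡ 0ℚ
  γ₀*six≡0 = begin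
    γ zero * six
      ≡⟨ sym (ℚP.+-identityʳ _) ⟩
    γ zero * six + 0ℚ
      ≡⟨ cong₂ _+_ (cong (γ zero *_) (sym (cutAt-dual-refl K)))
                   (sym (⟨⟩-comb-orthogonal (cutAt K) (map 𝟙 L) (γ ∘ suc)
                          (AllP.map⁺ (All.map cutAt-dual-≢ K∉L)))) ⟩
    γ zero * ⟨ cutAt K , 𝟙 K ⟩ + ⟨ cutAt K , comb (map 𝟙 L) (γ ∘ suc) ⟩
      ≡⟨ sym (⟨⟩-comb-∷ (cutAt K) (𝟙 K) (map 𝟙 L) γ) ⟩
    ⟨ cutAt K , comb (map 𝟙 (K ∷ L)) γ ⟩
      ≡⟨ ⟨⟩-zeroʳ (cutAt K) _ comb≗0 ⟩
    0ℚ ∎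
    where open ≡-Reasoning
  γ₀≡0 : γ zero ≡ 0ℚ
  γ₀≡0 = *-cancelˡ-≡-pos six (trans (ℚP.*-comm six (γ zero)) γ₀*six≡0)
  tail≗0 : ∀ e → comb (map 𝟙 L) (γ ∘ suc) e ≡ 0ℚ
  tail≗0 e = begin
    comb (map 𝟙 L) (γ ∘ suc) e                ≡⟨ sym (ℚP.+-identityˡ _) ⟩
    0ℚ + comb (map 𝟙 L) (γ ∘ suc) e           ≡⟨ cong (_+ comb (map 𝟙 L) (γ ∘ suc) e) (sym γ₀𝟙K≡0) ⟩
    γ zero * 𝟙 K e + comb (map 𝟙 L) (γ ∘ suc) e ≡⟨ comb≗0 e ⟩
    0ℚ                                         ∎
    where
    open ≡-Reasoning
    γ₀𝟙K≡0 : γ zero * 𝟙 K e ≡ 0ℚ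
    γ₀𝟙K≡0 = trans (cong (_* 𝟙 K e) γ₀≡0) (ℚP.*-zeroˡ (𝟙 K e))

comb-zero : ∀ vs e → comb vs (λ _ → 0ℚ) e ≡ 0ℚ
comb-zero []       e = refl
comb-zero (v ∷ vs) e = cong₂ _+_ (ℚP.*-zeroˡ (v e)) (comb-zero vs e)

minusOneAt : {w : Vector} {vs : List Vector} → w ∈ vs → Fin (length vs) → ℚ
minusOneAt (here _)  zero    = - 1ℚ
minusOneAt (here _)  (suc _) = 0ℚ
minusOneAt (there _) zero    = 0ℚ
minusOneAt (there p) (suc ℓ) = minusOneAt p ℓ

comb-minusOneAt : {w : Vector} {vs : List Vector} (p : w ∈ vs) (e : Edge) → comb vs (minusOneAt p) e ≡ - w e
comb-minusOneAt {vs = v ∷ vs} (here refl) e =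
  trans (cong₂ _+_ (sym (ℚP.neg-distribˡ-* 1ℚ (v e))) (comb-zero vs e))
        (trans (ℚP.+-identityʳ _) (cong -_ (ℚP.*-identityˡ (v e))))
comb-minusOneAt {vs = v ∷ vs} (there p) e =
  trans (cong₂ _+_ (ℚP.*-zeroˡ (v e)) (comb-minusOneAt p e)) (ℚP.+-identityˡ _)

linIndep-∷⇒∉ : ∀ v vs → LinIndep (v ∷ vs) → ¬ v ∈ vs
linIndep-∷⇒∉ v vs li v∈vs = ℚP.1≢0 (li coeffs comb≗0 zero)
  where
  coeffs : Fin (suc (length vs)) → ℚ
  coeffs zero    = 1ℚ
  coeffs (suc ℓ) = minusOneAt v∈vs ℓ
  comb≗0 : ∀ e → comb (v ∷ vs) coeffs e ≡ 0ℚ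
  comb≗0 e = trans (cong₂ _+_ (ℚP.*-identityˡ (v e)) (comb-minusOneAt v∈vs e)) (ℚP.+-inverseʳ (v e))

linIndep-tail : ∀ v vs → LinIndep (v ∷ vs) → LinIndep vs
linIndep-tail v vs li γ comb≗0 ℓ = li coeffs comb′≗0 (suc ℓ)
  where
  coeffs : Fin (suc (length vs)) → ℚ
  coeffs zero    = 0ℚ
  coeffs (suc m) = γ m
  comb′≗0 : ∀ e → comb (v ∷ vs) coeffs e ≡ 0ℚ
  comb′≗0 e = trans (cong (_+ comb vs γ e) (ℚP.*-zeroˡ (v e))) (trans (ℚP.+-identityˡ _) (comb≗0 e))

linIndep⇒unique : {A : Set} (v : A → Vector) (L : List A) → LinIndep (map v L) → Unique L
linIndep⇒unique v []      _  = []
linIndep⇒unique v (x ∷ L) li =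
  All.tabulate (λ { x∈L refl → linIndep-∷⇒∉ (v x) (map v L) li (∈-map⁺ v x∈L) })
  ∷ linIndep⇒unique v L (linIndep-tail (v x) (map v L) li)

module _ {A : Set} where

  ∈-─ : ∀ {x y : A} {ys} (x∈ys : x ∈ ys) → y ∈ ys → y ≢ x → y ∈ (ys Any.─ x∈ys)
  ∈-─ (here refl) (here refl) y≢x = ⊥-elim (y≢x refl)
  ∈-─ (here _)    (there y∈ys) _  = y∈ys
  ∈-─ (there _)   (here refl) _   = here refl
  ∈-─ (there x∈ys) (there y∈ys) y≢x = there (∈-─ x∈ys y∈ys y≢x)

  unique-⊆⇒length≤ : {xs ys : List A} → Unique xs → xs ⊆ ys → length xs ℕ.≤ length ys
  unique-⊆⇒length≤ {[]}     _                  _     = z≤n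
  unique-⊆⇒length≤ {x ∷ xs} {ys} (x∉xs ∷ xs-unique) xs⊆ys =
    subst (suc (length xs) ℕ.≤_) (sym (length-removeAt′ ys (Any.index x∈ys)))
      (s≤s (unique-⊆⇒length≤ xs-unique λ y∈xs →
        ∈-─ x∈ys (xs⊆ys (there y∈xs)) λ { refl → All.lookup x∉xs y∈xs refl }))
    where
    x∈ys : x ∈ ys
    x∈ys = xs⊆ys (here refl)

  module _ {P : A → Set} (P? : Decidable P) where

    length-filter-∁ : ∀ xs → length (filter P? xs) ℕ.+ length (filter (∁? P?) xs) ≡ length xs
    length-filter-∁ []       = refl
    length-filter-∁ (x ∷ xs) with P? x
    ... | yes _ = cong suc (length-filter-∁ xs)
    ... | no  _ = trans (ℕP.+-suc _ _) (cong suc (length-filter-∁ xs))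

    unique-counterexample : ∀ xs → suc (length (filter P? xs)) ≡ length xs →
                            Σ A λ x → ¬ P x × (∀ {y} → y ∈ xs → ¬ P y → y ≡ x)
    unique-counterexample xs count
      with filter (∁? P?) xs
         | (λ {v} → ∈-filter⁻ (∁? P?) {v = v} {xs = xs})
         | (λ {x} → ∈-filter⁺ (∁? P?) {x = x} {xs = xs})
         | one-failure
      where
      one-failure : length (filter (∁? P?) xs) ≡ 1
      one-failure = ℕP.+-cancelˡ-≡ (length (filter P? xs)) _ _
                      (trans (length-filter-∁ xs) (trans (sym count) (ℕP.+-comm 1 _)))
    ... | x ∷ [] | from | to | _ =
      x , proj₂ (from (here refl)) , λ y∈xs ¬Py → case-singleton (to y∈xs ¬Py)
      where
      case-singleton : ∀ {y} → y ∈ x ∷ [] → y ≡ x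
      case-singleton (here y≡x) = y≡x

hasRank-unique : ∀ {P : Triangle → Set} {r s} → HasRank P r → HasRank P s → r ≡ s
hasRank-unique ((L , P-L , |L|≡r , L-indep) , ≤r) ((M , P-M , |M|≡s , M-indep) , ≤s) =
  ℕP.≤-antisym (subst (ℕ._≤ _) |L|≡r (≤s L P-L L-indep)) (subst (ℕ._≤ _) |M|≡s (≤r M P-M M-indep))

hasRank-filter : {P : Triangle → Set} (P? : Decidable P) → HasRank P (length (filter P? triangles))
hasRank-filter P? =
  (filter P? triangles , all-filter P? triangles , refl ,
   unique⇒linIndep _ (UniqueP.filter⁺ P? triangles-unique)) ,
  λ L P-L L-indep → unique-⊆⇒length≤ (linIndep⇒unique 𝟙 L L-indep)
                      λ {K} K∈L → ∈-filter⁺ P? (∈-triangles K) (All.lookup P-L K∈L)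

-- Facet normals

record IsScaledCutAt (K : Triangle) (y : Vector) : Set where
  constructor scaled
  field
    scale        : ℚ
    0<scale      : 0ℚ < scale
    ≗scale·cutAt : ∀ e → y e ≡ scale * cutAt K e

TightAllBut : Triangle → Vector → Set
TightAllBut K y = ∀ K′ → Tight y K′ ⇔ K ≢ K′

tight? : ∀ y → Decidable (Tight y)
tight? y K = ⟨ y , 𝟙 K ⟩ ℚP.≟ 0ℚ

·cutAt-pairing : ∀ γ K K′ → ⟨ γ · cutAt K , 𝟙 K′ ⟩ ≡ γ * (six * δ _≟ᵀ_ K K′)
·cutAt-pairing γ K K′ = trans (⟨⟩-·ˡ γ (cutAt K) (𝟙 K′)) (cong (γ *_) (cutAt-dual K K′))

isScaledCutAt-pairing : ∀ {K y} (scaledCut : IsScaledCutAt K y) →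
                        ∀ K′ → ⟨ y , 𝟙 K′ ⟩ ≡ IsScaledCutAt.scale scaledCut * (six * δ _≟ᵀ_ K K′)
isScaledCutAt-pairing {K} (scaled γ _ y≗γcut) K′ =
  trans (∑-cong edges λ e → cong (_* 𝟙 K′ e) (y≗γcut e)) (·cutAt-pairing γ K K′)

isScaledCutAt-pairing-self : ∀ {K y} (scaledCut : IsScaledCutAt K y) →
                             ⟨ y , 𝟙 K ⟩ ≡ IsScaledCutAt.scale scaledCut * six
isScaledCutAt-pairing-self {K} scaledCut@(scaled γ _ _) =
  trans (isScaledCutAt-pairing scaledCut K) (cong (λ d → γ * (six * d)) (δ-refl _≟ᵀ_ K))

isScaledCutAt-tight : ∀ {K y} → IsScaledCutAt K y → ∀ {K′} → K ≢ K′ → Tight y K′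
isScaledCutAt-tight {K} scaledCut@(scaled γ _ _) {K′} K≢K′ =
  trans (isScaledCutAt-pairing scaledCut K′)
        (trans (cong (λ d → γ * (six * d)) (δ-≢ _≟ᵀ_ K≢K′)) (ℚP.*-zeroʳ γ))

isScaledCutAt-pairing-self-pos : ∀ {K y} → IsScaledCutAt K y → 0ℚ < ⟨ y , 𝟙 K ⟩
isScaledCutAt-pairing-self-pos scaledCut@(scaled γ 0<γ _) =
  subst (0ℚ <_) (sym (isScaledCutAt-pairing-self scaledCut)) (ℚP.*-monoˡ-<-pos six 0<γ)

isScaledCutAt⇒valid : ∀ {K y} → IsScaledCutAt K y → Valid y
isScaledCutAt⇒valid {K} scaledCut K′ with K ≟ᵀ K′
... | yes refl  = ℚP.<⇒≤ (isScaledCutAt-pairing-self-pos scaledCut)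
... | no  K≢K′ = ℚP.≤-reflexive (sym (isScaledCutAt-tight scaledCut K≢K′))

isScaledCutAt⇒tightAllBut : ∀ {K y} → IsScaledCutAt K y → TightAllBut K y
isScaledCutAt⇒tightAllBut scaledCut K′ =
  mk⇔ (λ { tight refl → ℚP.<-irrefl (sym tight) (isScaledCutAt-pairing-self-pos scaledCut) })
      (isScaledCutAt-tight scaledCut)

tightAllBut-count : ∀ {K} y → TightAllBut K y → length (filter (tight? y) triangles) ≡ 9
tightAllBut-count {K} y tightAllBut =
  trans (cong length (filter-≐ (tight? y) (λ K′ → ¬? (K ≟ᵀ K′))
                        ((λ {K′} → Equivalence.to (tightAllBut K′)) ,
                         (λ {K′} → Equivalence.from (tightAllBut K′)))
                        triangles))
        (∀-triangles table K)
  where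
  table = toWitness {a? = All.all? (λ K → length (filter (λ K′ → ¬? (K ≟ᵀ K′)) triangles) ℕ.≟ 9) triangles} _

isScaledCutAt⇒facetNormal : ∀ {K y} → IsScaledCutAt K y → IsFacetNormal y
isScaledCutAt⇒facetNormal {y = y} scaledCut =
  isScaledCutAt⇒valid scaledCut , 9 , hasRank-filter (λ _ → yes tt) ,
  subst (HasRank (Tight y)) (tightAllBut-count y (isScaledCutAt⇒tightAllBut scaledCut))
        (hasRank-filter (tight? y))

-- Distinct triangles are independent, so ranks are counts: nine of the ten triangles are tight.
facetNormal⇒tightAllBut : ∀ y → IsFacetNormal y → Σ Triangle λ K → TightAllBut K y
facetNormal⇒tightAllBut y (_ , d , rank-all , rank-tight)
  with unique-counterexample (tight? y) triangles count
  where
  count : suc (length (filter (tight? y) triangles)) ≡ 10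
  count = trans (cong suc (hasRank-unique (hasRank-filter (tight? y)) rank-tight))
                (hasRank-unique rank-all (hasRank-filter (λ _ → yes tt)))
... | K , loose , only-loose = K , λ K′ → mk⇔
  (λ { tight refl → loose tight })
  (λ K≢K′ → decidable-stable (tight? y K′) λ loose′ → K≢K′ (sym (only-loose (∈-triangles K′) loose′)))

tightAllBut⇒isScaledCutAt : ∀ {K} y → Valid y → TightAllBut K y → IsScaledCutAt K y
tightAllBut⇒isScaledCutAt {K} y valid tightAllBut =
  scaled γ (ℚP.*-monoˡ-<-pos sixth 0<⟨y,𝟙K⟩)
    (triangle-pairing-injective y (γ · cutAt K) pairings-agree)
  where
  sixth : ℚ
  sixth = ℤ.+ 1 / 6
  γ : ℚ
  γ = ⟨ y , 𝟙 K ⟩ * sixth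
  0<⟨y,𝟙K⟩ : 0ℚ < ⟨ y , 𝟙 K ⟩
  0<⟨y,𝟙K⟩ = ≤∧≢⇒< (valid K) λ 0≡⟨y,𝟙K⟩ → Equivalence.to (tightAllBut K) (sym 0≡⟨y,𝟙K⟩) refl
  pairings-agree : ∀ K′ → ⟨ y , 𝟙 K′ ⟩ ≡ ⟨ γ · cutAt K , 𝟙 K′ ⟩
  pairings-agree K′ with K ≟ᵀ K′
  ... | yes refl = sym (begin
    ⟨ γ · cutAt K , 𝟙 K ⟩         ≡⟨ ·cutAt-pairing γ K K ⟩
    γ * (six * δ _≟ᵀ_ K K)        ≡⟨ cong (λ d → γ * (six * d)) (δ-refl _≟ᵀ_ K) ⟩
    ⟨ y , 𝟙 K ⟩ * sixth * six     ≡⟨ ℚP.*-assoc ⟨ y , 𝟙 K ⟩ sixth six ⟩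
    ⟨ y , 𝟙 K ⟩ * 1ℚ              ≡⟨ ℚP.*-identityʳ ⟨ y , 𝟙 K ⟩ ⟩
    ⟨ y , 𝟙 K ⟩                   ∎)
    where open ≡-Reasoning
  ... | no K≢K′ = begin
    ⟨ y , 𝟙 K′ ⟩                  ≡⟨ Equivalence.from (tightAllBut K′) K≢K′ ⟩
    0ℚ                            ≡⟨ sym (ℚP.*-zeroʳ γ) ⟩
    γ * (six * 0ℚ)                ≡⟨ cong (λ d → γ * (six * d)) (sym (δ-≢ _≟ᵀ_ K≢K′)) ⟩
    γ * (six * δ _≟ᵀ_ K K′)       ≡⟨ sym (·cutAt-pairing γ K K′) ⟩
    ⟨ γ · cutAt K , 𝟙 K′ ⟩        ∎
    where open ≡-Reasoning

∣∁vertices∣ : ∀ K → ∣ ∁ (vertices K) ∣ ≡ 2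
∣∁vertices∣ = ∀-triangles (toWitness {a? = All.all? (λ K → ∣ ∁ (vertices K) ∣ ℕ.≟ 2) triangles} _)

∣∣≡2⇒∁vertices : ∀ A → ∣ A ∣ ≡ 2 → Σ Triangle λ K → A ≡ ∁ (vertices K)
∣∣≡2⇒∁vertices A ∣A∣≡2 =
  Any.satisfied (decidable-stable (is-∁vertices? A) λ none → no-counterexample (A , ∣A∣≡2 , none))
  where
  is-∁vertices? : ∀ A → Dec (Any (λ K → A ≡ ∁ (vertices K)) triangles)
  is-∁vertices? A = Any.any? (λ K → VecP.≡-dec BoolP._≟_ A (∁ (vertices K))) triangles
  no-counterexample : ¬ ∃ λ A → ∣ A ∣ ≡ 2 × ¬ Any (λ K → A ≡ ∁ (vertices K)) triangles
  no-counterexample = toWitness {a? = ¬? (anySubset? λ A → (∣ A ∣ ℕ.≟ 2) ×-dec ¬? (is-∁vertices? A))} _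

IsCut₂₃Multiple : Vector → Set
IsCut₂₃Multiple y =
  Σ (Subset 5) (λ A → ∣ A ∣ ≡ 2 × Σ ℚ (λ γ → 0ℚ < γ × ((e : Edge) → y e ≡ γ * cut A e)))

cut₂₃Multiple⇒isScaledCutAt : ∀ {y} → IsCut₂₃Multiple y → Σ Triangle λ K → IsScaledCutAt K y
cut₂₃Multiple⇒isScaledCutAt (A , ∣A∣≡2 , γ , 0<γ , y≗γcut) with ∣∣≡2⇒∁vertices A ∣A∣≡2
... | K , refl = K , scaled γ 0<γ y≗γcut

isScaledCutAt⇒cut₂₃Multiple : ∀ {K y} → IsScaledCutAt K y → IsCut₂₃Multiple y
isScaledCutAt⇒cut₂₃Multiple {K} (scaled γ 0<γ y≗γcut) = ∁ (vertices K) , ∣∁vertices∣ K , γ , 0<γ , y≗γcut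

facetOmitting : Triangle → Triangle → Bool
facetOmitting K K′ = does (¬? (K ≟ᵀ K′))

facetOmitting-true⇔ : ∀ K K′ → facetOmitting K K′ ≡ true ⇔ K ≢ K′
facetOmitting-true⇔ K K′ with K ≟ᵀ K′
... | yes K≡K′ = mk⇔ (λ ()) (λ K≢K′ → ⊥-elim (K≢K′ K≡K′))
... | no  K≢K′ = mk⇔ (λ _ → K≢K′) (λ _ → refl)

tightAllBut⇔facetOmitting : ∀ {K} y → TightAllBut K y → ∀ K′ → Tight y K′ ⇔ facetOmitting K K′ ≡ true
tightAllBut⇔facetOmitting {K} y tightAllBut K′ = ⇔-sym (facetOmitting-true⇔ K K′) ⇔-∘ tightAllBut K′

facets : List (Triangle → Bool)
facets = map facetOmitting triangles

facetOmitting-injective : ∀ {K K′} → K ≢ K′ → ¬ facetOmitting K ≗ facetOmitting K′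
facetOmitting-injective {K} {K′} K≢K′ same =
  Equivalence.to (facetOmitting-true⇔ K K)
    (trans (same K) (Equivalence.from (facetOmitting-true⇔ K′ K) (K≢K′ ∘ sym))) refl

facets-distinct : AllPairs (λ S T → ¬ S ≗ T) facets
facets-distinct = AllPairsP.map⁺ (AllPairs.map facetOmitting-injective triangles-unique)

isFacet⇒∈facets : ∀ {S} → IsFacet S → Any (S ≗_) facets
isFacet⇒∈facets {S} (y , normal , S⇔tight) = ∈facets (proj₂ (facetNormal⇒tightAllBut y normal))
  where
  ∈facets : ∀ {K} → TightAllBut K y → Any (S ≗_) facets
  ∈facets {K} tightAllBut =
    AnyP.map⁺ {f = facetOmitting} {P = S ≗_} (Any.map (λ { refl → S≗facet }) (∈-triangles K))
    where
    S≗facet : S ≗ facetOmitting K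
    S≗facet K′ = BoolP.⇔→≡ (tightAllBut⇔facetOmitting y tightAllBut K′
                               ⇔-∘ mk⇔ (proj₁ (S⇔tight K′)) (proj₂ (S⇔tight K′)))

∈facets⇒isFacet : ∀ {S} → Any (S ≗_) facets → IsFacet S
∈facets⇒isFacet {S} S∈facets
  with Any.satisfied (AnyP.map⁻ {f = facetOmitting} {P = S ≗_} {xs = triangles} S∈facets)
... | K , S≗facet =
  cutAt K , isScaledCutAt⇒facetNormal scaledCut ,
  λ K′ → (λ S≡true → Equivalence.from (tight⇔facet K′) (trans (sym (S≗facet K′)) S≡true))
       , (λ tight → trans (S≗facet K′) (Equivalence.to (tight⇔facet K′) tight))
  where
  scaledCut : IsScaledCutAt K (cutAt K)
  scaledCut = scaled 1ℚ (ℚP.positive⁻¹ 1ℚ) λ e → sym (ℚP.*-identityˡ (cutAt K e))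
  tight⇔facet : ∀ K′ → Tight (cutAt K) K′ ⇔ facetOmitting K K′ ≡ true
  tight⇔facet = tightAllBut⇔facetOmitting (cutAt K) (isScaledCutAt⇒tightAllBut scaledCut)

facetNormal⇒cut₂₃Multiple : ∀ y → IsFacetNormal y → IsCut₂₃Multiple y
facetNormal⇒cut₂₃Multiple y normal@(valid , _) =
  isScaledCutAt⇒cut₂₃Multiple (tightAllBut⇒isScaledCutAt y valid (proj₂ (facetNormal⇒tightAllBut y normal)))

cut₂₃Multiple⇒facetNormal : ∀ y → IsCut₂₃Multiple y → IsFacetNormal y
cut₂₃Multiple⇒facetNormal y multiple =
  isScaledCutAt⇒facetNormal (proj₂ (cut₂₃Multiple⇒isScaledCutAt multiple))

corollary4p2 :
    ((y : Vector) →
      (IsFacetNormal y →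
         Σ (Subset 5) (λ A → ∣ A ∣ ≡ 2 × Σ ℚ (λ γ → 0ℚ < γ × ((e : Edge) → y e ≡ γ * cut A e))))
      × (Σ (Subset 5) (λ A → ∣ A ∣ ≡ 2 × Σ ℚ (λ γ → 0ℚ < γ × ((e : Edge) → y e ≡ γ * cut A e)))
           → IsFacetNormal y))
    × Σ (List (Triangle → Bool)) (λ L →
        length L ≡ 10
        × AllPairs (λ S T → ¬ ((K : Triangle) → S K ≡ T K)) L
        × ((S : Triangle → Bool) →
             (IsFacet S → Any (λ T → (K : Triangle) → S K ≡ T K) L)
             × (Any (λ T → (K : Triangle) → S K ≡ T K) L → IsFacet S)))
corollary4p2 =
  (λ y → facetNormal⇒cut₂₃Multiple y , cut₂₃Multiple⇒facetNormal y) ,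
  facets , refl , facets-distinct , λ S → isFacet⇒∈facets , ∈facets⇒isFacet
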